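{- Let $m,p$ be real numbers and $\alpha,\beta$ integers, and let $\{a_n\}_{n\ge0}$, $\{b_n\}_{n\ge0}$ be sequences of real (or complex) numbers such that for all $n=0,1,2,\ldots$, $$\sum_{k=0}^n\binom{n-m}{k}(-1)^{n-k}a_{n-k}=(-1)^\alpha a_n\quad\text{and}\quad\sum_{k=0}^n\binom{n-p}{k}(-1)^{n-k}b_{n-k}=(-1)^\beta b_n.$$ If $n$ is a nonnegative integer such that $\alpha+\beta+n$ is odd, then $$\sum_{k=0}^n\frac{\binom{n-m}{k}\binom{n-p}{n-k}}{\binom nk}(-1)^ka_{n-k}b_k=0.$$
   Context: For real $x$ and a nonnegative integer $k$, $\binom xk=x(x-1)\cdots(x-k+1)/k!$ (with $\binom x0=1$). -}

module Defs where

open import Level using (_⊔_) renaming (suc to lsuc)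
open import Algebra.Bundles using (CommutativeRing)
open import Data.Nat using (ℕ; zero; suc; _∸_; _!)
open import Data.Integer using (ℤ; ∣_∣)
open import Relation.Nullary using (¬_)

module _ {c ℓ} (R : CommutativeRing c ℓ) where
  open CommutativeRing R
  ι : ℕ → Carrier
  ι zero = 0#
  ι (suc n) = 1# + ι n

-- A field of characteristic 0 (the stdlib has no Field bundle).
-- The reals (and complexes) are instances.  inv 0# is unconstrained (junk).
record Char0Field (c ℓ : Level.Level) : Set (lsuc (c ⊔ ℓ)) where
  field
    commutativeRing : CommutativeRing c ℓ
  open CommutativeRing commutativeRing public
  field
    inv : Carrier → Carrier
    inv-inverse : ∀ x → ¬ (x ≈ 0#) → x * inv x ≈ 1#
    char0 : ∀ n → ¬ (ι commutativeRing (suc n) ≈ 0#)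

  ιℕ : ℕ → Carrier
  ιℕ = ι commutativeRing

  _÷_ : Carrier → Carrier → Carrier
  x ÷ y = x * inv y

  sgn : ℕ → Carrier
  sgn zero = 1#
  sgn (suc n) = - sgn n

  sgnℤ : ℤ → Carrier
  sgnℤ α = sgn ∣ α ∣

  falling : Carrier → ℕ → Carrier
  falling x zero = 1#
  falling x (suc k) = falling x k * (x - ιℕ k)

  binom : Carrier → ℕ → Carrier
  binom x k = falling x k ÷ ιℕ (k !)

  sumTo : ℕ → (ℕ → Carrier) → Carrier
  sumTo zero f = f 0
  sumTo (suc n) f = sumTo n f + f (suc n)

module Submission where

open import Defs
open import Data.Nat using (ℕ; _∸_; _%_)
open import Data.Nat.Combinatorics using (_C_)
open import Data.Integer using (ℤ; ∣_∣; +_) renaming (_+_ to _+ℤ_)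
open import Relation.Binary.PropositionalEquality using (_≡_)

open import Data.Nat using (zero; suc; z≤n; _!; NonZero)
  renaming (_+_ to _+ℕ_; _*_ to _*ℕ_; _≤_ to _≤ℕ_)
import Data.Nat.Properties as NP
import Data.Nat.DivMod as NDM
import Data.Nat.Combinatorics as NC
import Data.Integer as Z
import Data.Integer.Properties as ZP
import Relation.Binary.PropositionalEquality as P
open import Relation.Nullary using (¬_)

-- Write M = n - m, Q = n - p and (x)_k for the falling factorial.  As
-- binom(M,k) binom(Q,n-k) / binom(n,k) = (M)_k (Q)_(n-k) / n!, the theorem says
-- that Φ = Σ_k (M)_k (Q)_(n-k) (-1)^k a_(n-k) b_k vanishes.  Sum the triangular array
--   entry(k,i) = (M)_k / (k-i)! · (Q)_(n-i) · (-1)^i (-1)^(n-k) a_(n-k) b_i,  i ≤ k ≤ n,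
-- in both orders.  By columns (k = i + t, using (M)_(i+t) = (M)_i (n-i-m)_t) each
-- inner sum is the eigen-relation of a at n - i, giving ε_a Φ; by rows (using
-- (Q)_(n-i) = (Q)_(n-k) (k-p)_(k-i)) each is the reversed eigen-relation of b at k,
-- giving (-1)^n ε_b Φ.  So ε_a Φ = (-1)^n ε_b Φ for any eigenvalues; with
-- ε_a = (-1)^α, ε_b = (-1)^β and α + β + n odd this is Φ = -Φ, so Φ = 0 in
-- characteristic 0.  The module Development proves, in order: arithmetic of ι and
-- signs, finite sums (reversal, triangular exchange), falling factorials, field
-- facts, and the identity eigen-convolution; the theorem comes last.

module Development {c ℓ} (F : Char0Field c ℓ) where
  open Char0Field F
  open import Algebra.Solver.Ring.NaturalCoefficients.Default commutativeSemiring
  open import Relation.Binary.Reasoning.Setoid setoid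
  open import Algebra.Properties.Ring ring using (-‿involutive; -‿distribˡ-*; -‿distribʳ-*; -1*x≈-x)
  open import Algebra.Properties.AbelianGroup +-abelianGroup using (⁻¹-∙-comm)

  ι-+ : ∀ a b → ιℕ (a +ℕ b) ≈ ιℕ a + ιℕ b
  ι-+ zero    b = sym (+-identityˡ _)
  ι-+ (suc a) b = trans (+-cong refl (ι-+ a b)) (sym (+-assoc _ _ _))

  ι-* : ∀ a b → ιℕ (a *ℕ b) ≈ ιℕ a * ιℕ b
  ι-* zero    b = sym (zeroˡ _)
  ι-* (suc a) b = begin
    ιℕ (b +ℕ a *ℕ b)        ≈⟨ ι-+ b (a *ℕ b) ⟩
    ιℕ b + ιℕ (a *ℕ b)      ≈⟨ +-cong (sym (*-identityˡ _)) (ι-* a b) ⟩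
    1# * ιℕ b + ιℕ a * ιℕ b ≈⟨ sym (distribʳ _ _ _) ⟩
    (1# + ιℕ a) * ιℕ b      ∎

  ι-∸ : ∀ {n i} → i ≤ℕ n → ιℕ n ≈ ιℕ (n ∸ i) + ιℕ i
  ι-∸ {n} {i} i≤n = trans (reflexive (P.cong ιℕ (P.sym (NP.m∸n+n≡m i≤n)))) (ι-+ (n ∸ i) i)

  ι-nonzero : ∀ j → .{{NonZero j}} → ¬ ιℕ j ≈ 0#
  ι-nonzero (suc j) = char0 j

  sgn-+ : ∀ a b → sgn (a +ℕ b) ≈ sgn a * sgn b
  sgn-+ zero    b = sym (*-identityˡ _)
  sgn-+ (suc a) b = trans (-‿cong (sgn-+ a b)) (-‿distribˡ-* _ _)

  sgn-square : ∀ a → sgn a * sgn a ≈ 1#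
  sgn-square zero    = *-identityˡ _
  sgn-square (suc a) = begin
    - sgn a * - sgn a   ≈⟨ sym (-‿distribˡ-* _ _) ⟩
    - (sgn a * - sgn a) ≈⟨ -‿cong (sym (-‿distribʳ-* _ _)) ⟩
    - - (sgn a * sgn a) ≈⟨ -‿involutive _ ⟩
    sgn a * sgn a       ≈⟨ sgn-square a ⟩
    1#                  ∎

  -- (-1)^(n-k) = (-1)^n (-1)^k, because (-1)^k is its own inverse.
  sgn-∸ : ∀ {n k} → k ≤ℕ n → sgn (n ∸ k) ≈ sgn n * sgn k
  sgn-∸ {n} {k} k≤n = begin
    sgn (n ∸ k)                   ≈⟨ sym (*-identityʳ _) ⟩
    sgn (n ∸ k) * 1#              ≈⟨ *-cong refl (sym (sgn-square k)) ⟩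
    sgn (n ∸ k) * (sgn k * sgn k) ≈⟨ sym (*-assoc _ _ _) ⟩
    sgn (n ∸ k) * sgn k * sgn k   ≈⟨ *-cong (sym (sgn-+ (n ∸ k) k)) refl ⟩
    sgn (n ∸ k +ℕ k) * sgn k      ≡⟨ P.cong (λ j → sgn j * sgn k) (NP.m∸n+n≡m k≤n) ⟩
    sgn n * sgn k                 ∎

  sgn-odd : ∀ k → k % 2 ≡ 1 → sgn k ≈ - 1#
  sgn-odd k odd = begin
    sgn k                                 ≡⟨ P.cong sgn (NDM.m≡m%n+[m/n]*n k 2) ⟩
    sgn (k % 2 +ℕ (k NDM./ 2) *ℕ 2)       ≈⟨ sgn-+ (k % 2) ((k NDM./ 2) *ℕ 2) ⟩
    sgn (k % 2) * sgn ((k NDM./ 2) *ℕ 2)  ≈⟨ *-cong (reflexive (P.cong sgn odd)) (sgn-even (k NDM./ 2)) ⟩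
    - 1# * 1#                             ≈⟨ *-identityʳ _ ⟩
    - 1#                                  ∎
    where
    sgn-even : ∀ j → sgn (j *ℕ 2) ≈ 1#
    sgn-even zero    = refl
    sgn-even (suc j) = trans (-‿involutive _) (sgn-even j)

  sgn-⊖ : ∀ x y → sgn ∣ x Z.⊖ y ∣ ≈ sgn (x +ℕ y)
  sgn-⊖ zero    zero    = refl
  sgn-⊖ zero    (suc y) = refl
  sgn-⊖ (suc x) zero    = reflexive (P.cong sgn (P.sym (NP.+-identityʳ (suc x))))
  sgn-⊖ (suc x) (suc y) rewrite ZP.[1+m]⊖[1+n]≡m⊖n x y | NP.+-suc x y =
    trans (sgn-⊖ x y) (sym (-‿involutive _))

  sgnℤ-+ : ∀ x y → sgnℤ (x +ℤ y) ≈ sgnℤ x * sgnℤ y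
  sgnℤ-+ (+ x)      (+ y)      = sgn-+ x y
  sgnℤ-+ (+ x)      Z.-[1+ y ] = trans (sgn-⊖ x (suc y)) (sgn-+ x (suc y))
  sgnℤ-+ Z.-[1+ x ] (+ y)      = trans (sgn-⊖ y (suc x)) (trans (sgn-+ y (suc x)) (*-comm _ _))
  sgnℤ-+ Z.-[1+ x ] Z.-[1+ y ] =
    trans (-‿cong (reflexive (P.cong sgn (P.sym (NP.+-suc x y))))) (sgn-+ (suc x) (suc y))

  odd-sign : ∀ α β n → ∣ α +ℤ β +ℤ + n ∣ % 2 ≡ 1 → sgnℤ α * sgnℤ β * sgn n ≈ - 1#
  odd-sign α β n odd = begin
    sgnℤ α * sgnℤ β * sgn n    ≈⟨ *-cong (sym (sgnℤ-+ α β)) refl ⟩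
    sgnℤ (α +ℤ β) * sgnℤ (+ n) ≈⟨ sym (sgnℤ-+ (α +ℤ β) (+ n)) ⟩
    sgnℤ (α +ℤ β +ℤ + n)       ≈⟨ sgn-odd ∣ α +ℤ β +ℤ + n ∣ odd ⟩
    - 1#                       ∎

  sum-cong : ∀ n {f g : ℕ → Carrier} → (∀ k → k ≤ℕ n → f k ≈ g k) → sumTo n f ≈ sumTo n g
  sum-cong zero    f≈g = f≈g 0 z≤n
  sum-cong (suc n) f≈g = +-cong (sum-cong n (λ k k≤n → f≈g k (NP.m≤n⇒m≤1+n k≤n))) (f≈g (suc n) NP.≤-refl)

  sum-scale : ∀ n x f → sumTo n (λ k → x * f k) ≈ x * sumTo n f
  sum-scale zero    x f = refl
  sum-scale (suc n) x f = trans (+-cong (sum-scale n x f) refl) (sym (distribˡ _ _ _))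

  sum-+ : ∀ n f g → sumTo n (λ k → f k + g k) ≈ sumTo n f + sumTo n g
  sum-+ zero    f g = refl
  sum-+ (suc n) f g = begin
    sumTo n (λ k → f k + g k) + (f (suc n) + g (suc n)) ≈⟨ +-cong (sum-+ n f g) refl ⟩
    (sumTo n f + sumTo n g) + (f (suc n) + g (suc n))   ≈⟨ solve 4 (λ u v w z → (u :+ v) :+ (w :+ z) := (u :+ w) :+ (v :+ z)) refl _ _ _ _ ⟩
    (sumTo n f + f (suc n)) + (sumTo n g + g (suc n))   ∎

  sum-front : ∀ n f → sumTo (suc n) f ≈ f 0 + sumTo n (λ k → f (suc k))
  sum-front zero    f = refl
  sum-front (suc n) f = trans (+-cong (sum-front n f) refl) (+-assoc _ _ _)

  sum-reverse : ∀ n f → sumTo n f ≈ sumTo n (λ s → f (n ∸ s))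
  sum-reverse zero    f = refl
  sum-reverse (suc n) f = begin
    sumTo n f + f (suc n)                  ≈⟨ +-comm _ _ ⟩
    f (suc n) + sumTo n f                  ≈⟨ +-cong refl (sum-reverse n f) ⟩
    f (suc n) + sumTo n (λ s → f (n ∸ s))  ≈⟨ sym (sum-front n (λ s → f (suc n ∸ s))) ⟩
    sumTo (suc n) (λ s → f (suc n ∸ s))    ∎

  sum-triangle : ∀ n (g : ℕ → ℕ → Carrier) →
    sumTo n (λ k → sumTo k (g k)) ≈ sumTo n (λ i → sumTo (n ∸ i) (λ t → g (i +ℕ t) i))
  sum-triangle zero    g = refl
  sum-triangle (suc n) g = begin
    sumTo n (λ k → sumTo k (g k)) + sumTo (suc n) (g (suc n))
      ≈⟨ +-cong (sum-triangle n g) refl ⟩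
    columns n + (sumTo n (g (suc n)) + g (suc n) (suc n))
      ≈⟨ sym (+-assoc _ _ _) ⟩
    (columns n + sumTo n (g (suc n))) + g (suc n) (suc n)
      ≈⟨ +-cong (sym (sum-+ n _ _)) last-column ⟩
    sumTo n (λ i → sumTo (n ∸ i) (λ t → g (i +ℕ t) i) + g (suc n) i)
      + sumTo (suc n ∸ suc n) (λ t → g (suc n +ℕ t) (suc n))
      ≈⟨ +-cong (sum-cong n extend-column) refl ⟩
    columns (suc n) ∎
    where
    columns : ℕ → Carrier
    columns n = sumTo n (λ i → sumTo (n ∸ i) (λ t → g (i +ℕ t) i))
    last-column : g (suc n) (suc n) ≈ sumTo (suc n ∸ suc n) (λ t → g (suc n +ℕ t) (suc n))
    last-column rewrite NP.n∸n≡0 n | NP.+-identityʳ n = refl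
    -- the new row k = n+1 adds one entry at the bottom of every column i ≤ n
    extend-column : ∀ i → i ≤ℕ n →
      sumTo (n ∸ i) (λ t → g (i +ℕ t) i) + g (suc n) i ≈ sumTo (suc n ∸ i) (λ t → g (i +ℕ t) i)
    extend-column i i≤n rewrite NP.+-∸-assoc 1 i≤n | NP.+-suc i (n ∸ i) | NP.m+[n∸m]≡n i≤n = refl

  falling-cong : ∀ {x y} k → x ≈ y → falling x k ≈ falling y k
  falling-cong zero    x≈y = refl
  falling-cong (suc k) x≈y = *-cong (falling-cong k x≈y) (+-cong x≈y refl)

  falling-+ : ∀ x r s → falling x (r +ℕ s) ≈ falling x r * falling (x - ιℕ r) s
  falling-+ x r zero    rewrite NP.+-identityʳ r = sym (*-identityʳ _)
  falling-+ x r (suc s) rewrite NP.+-suc r s = begin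
    falling x (r +ℕ s) * (x - ιℕ (r +ℕ s))
      ≈⟨ *-cong (falling-+ x r s) (trans (+-cong refl (-‿cong (ι-+ r s))) sub-+) ⟩
    falling x r * falling (x - ιℕ r) s * ((x - ιℕ r) - ιℕ s)
      ≈⟨ *-assoc _ _ _ ⟩
    falling x r * (falling (x - ιℕ r) s * ((x - ιℕ r) - ιℕ s)) ∎
    where
    sub-+ : x - (ιℕ r + ιℕ s) ≈ (x - ιℕ r) - ιℕ s
    sub-+ = trans (+-cong refl (sym (⁻¹-∙-comm _ _))) (sym (+-assoc _ _ _))

  -- The shift that makes the eigen-relation appear inside the double sum:
  -- for i ≤ n,  (n - x)_(i+t) = (n - x)_i ((n - i) - x)_t.
  falling-shift : ∀ {n i} x t → i ≤ℕ n →
    falling (ιℕ n - x) (i +ℕ t) ≈ falling (ιℕ n - x) i * falling (ιℕ (n ∸ i) - x) t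
  falling-shift {n} {i} x t i≤n =
    trans (falling-+ (ιℕ n - x) i t) (*-cong refl (falling-cong t shifted-base))
    where
    shifted-base : (ιℕ n - x) - ιℕ i ≈ ιℕ (n ∸ i) - x
    shifted-base = begin
      (ιℕ n + - x) + - ιℕ i                    ≈⟨ +-cong (+-cong (ι-∸ i≤n) refl) refl ⟩
      ((ιℕ (n ∸ i) + ιℕ i) + - x) + - ιℕ i     ≈⟨ solve 4 (λ u v y w → ((u :+ v) :+ y) :+ w := (u :+ y) :+ (v :+ w)) refl _ _ _ _ ⟩
      (ιℕ (n ∸ i) + - x) + (ιℕ i + - ιℕ i)     ≈⟨ +-cong refl (-‿inverseʳ _) ⟩
      (ιℕ (n ∸ i) + - x) + 0#                  ≈⟨ +-identityʳ _ ⟩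
      ιℕ (n ∸ i) - x                           ∎

  -- Field facts: inverses are unique, and x = -x forces x = 0 since 2 ≠ 0.

  inv-unique : ∀ {y z} → ¬ y ≈ 0# → y * z ≈ 1# → z ≈ inv y
  inv-unique {y} {z} y≉0 yz≈1 = begin
    z                ≈⟨ sym (*-identityʳ _) ⟩
    z * 1#           ≈⟨ *-cong refl (sym (inv-inverse y y≉0)) ⟩
    z * (y * inv y)  ≈⟨ solve 3 (λ z y i → z :* (y :* i) := (y :* z) :* i) refl z y (inv y) ⟩
    (y * z) * inv y  ≈⟨ *-cong yz≈1 refl ⟩
    1# * inv y       ≈⟨ *-identityˡ _ ⟩
    inv y            ∎

  self-negative-zero : ∀ {x} → x ≈ - x → x ≈ 0#
  self-negative-zero {x} x≈-x = begin
    x                           ≈⟨ sym (*-identityʳ _) ⟩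
    x * 1#                      ≈⟨ *-cong refl (sym (inv-inverse (ιℕ 2) (ι-nonzero 2))) ⟩
    x * (ιℕ 2 * inv (ιℕ 2))     ≈⟨ solve 3 (λ x t i → x :* (t :* i) := i :* (t :* x)) refl x (ιℕ 2) _ ⟩
    inv (ιℕ 2) * (ιℕ 2 * x)     ≈⟨ *-cong refl double ⟩
    inv (ιℕ 2) * (x + x)        ≈⟨ *-cong refl (+-cong refl x≈-x) ⟩
    inv (ιℕ 2) * (x + - x)      ≈⟨ *-cong refl (-‿inverseʳ x) ⟩
    inv (ιℕ 2) * 0#             ≈⟨ zeroʳ _ ⟩
    0#                          ∎
    where
    double : ιℕ 2 * x ≈ x + x
    double = solve 1 (λ x → (con 1 :+ (con 1 :+ con 0)) :* x := x :+ x) refl x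

  -- binom(x,k) binom(y,n-k) / binom(n,k) = (x)_k (y)_(n-k) / n!, from
  -- binom(n,k) k! (n-k)! = n!.
  binom-ratio : ∀ {n k} x y → k ≤ℕ n →
    (binom x k * binom y (n ∸ k)) ÷ ιℕ (n C k) ≈ inv (ιℕ (n !)) * (falling x k * falling y (n ∸ k))
  binom-ratio {n} {k} x y k≤n = begin
    (falling x k * inv K * (falling y (n ∸ k) * inv L)) * inv B
      ≈⟨ solve 5 (λ a iK b iL iB → (a :* iK :* (b :* iL)) :* iB := (iK :* iL :* iB) :* (a :* b)) refl _ _ _ _ _ ⟩
    (inv K * inv L * inv B) * (falling x k * falling y (n ∸ k))
      ≈⟨ *-cong (inv-unique (ι-nonzero (n !) {{NP._!≢0 n}}) inverse-product) refl ⟩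
    inv (ιℕ (n !)) * (falling x k * falling y (n ∸ k)) ∎
    where
    K L B : Carrier
    K = ιℕ (k !)
    L = ιℕ ((n ∸ k) !)
    B = ιℕ (n C k)
    instance
      _ = NP._!*_!≢0 k (n ∸ k)
    factorials : (n C k) *ℕ (k ! *ℕ (n ∸ k) !) ≡ n !
    factorials = P.trans (P.cong (_*ℕ (k ! *ℕ (n ∸ k) !)) (NC.nCk≡n!/k![n-k]! k≤n))
                         (NDM.m/n*n≡m (NC.k![n∸k]!∣n! k≤n))
    B≉0 : ¬ B ≈ 0#
    B≉0 = ι-nonzero (n C k) {{NP.m*n≢0⇒m≢0 (n C k) {{P.subst NonZero (P.sym factorials) (NP._!≢0 n)}}}}
    inverse-product : ιℕ (n !) * (inv K * inv L * inv B) ≈ 1#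
    inverse-product = begin
      ιℕ (n !) * (inv K * inv L * inv B)
        ≡⟨ P.cong (λ j → ιℕ j * (inv K * inv L * inv B)) (P.sym factorials) ⟩
      ιℕ ((n C k) *ℕ (k ! *ℕ (n ∸ k) !)) * (inv K * inv L * inv B)
        ≈⟨ *-cong (trans (ι-* (n C k) _) (*-cong refl (ι-* (k !) ((n ∸ k) !)))) refl ⟩
      (B * (K * L)) * (inv K * inv L * inv B)
        ≈⟨ solve 6 (λ c a b ia ib ic → (c :* (a :* b)) :* (ia :* ib :* ic) := (a :* ia) :* (b :* ib) :* (c :* ic)) refl B K L _ _ _ ⟩
      (K * inv K) * (L * inv L) * (B * inv B)
        ≈⟨ *-cong (*-cong (inv-inverse K (ι-nonzero (k !) {{NP._!≢0 k}}))
                          (inv-inverse L (ι-nonzero ((n ∸ k) !) {{NP._!≢0 (n ∸ k)}})))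
                  (inv-inverse B B≉0) ⟩
      1# * 1# * 1#
        ≈⟨ trans (*-identityʳ _) (*-identityʳ _) ⟩
      1# ∎

  odd-sign-vanish : ∀ α β n {x} → ∣ α +ℤ β +ℤ + n ∣ % 2 ≡ 1 →
    sgnℤ α * x ≈ sgn n * (sgnℤ β * x) → x ≈ 0#
  odd-sign-vanish α β n {x} odd eq = self-negative-zero (begin
    x                                ≈⟨ sym (*-identityˡ _) ⟩
    1# * x                           ≈⟨ *-cong (sym (sgn-square ∣ α ∣)) refl ⟩
    sgnℤ α * sgnℤ α * x              ≈⟨ *-assoc _ _ _ ⟩
    sgnℤ α * (sgnℤ α * x)            ≈⟨ *-cong refl eq ⟩
    sgnℤ α * (sgn n * (sgnℤ β * x))  ≈⟨ solve 4 (λ A N B y → A :* (N :* (B :* y)) := (A :* B :* N) :* y) refl _ _ _ _ ⟩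
    sgnℤ α * sgnℤ β * sgn n * x      ≈⟨ *-cong (odd-sign α β n odd) refl ⟩
    - 1# * x                         ≈⟨ -1*x≈-x x ⟩
    - x                              ∎)

  -- a is an eigensequence with eigenvalue ε of the binomial transform with
  -- parameter m:  Σ_k binom(n-m,k) (-1)^(n-k) a_(n-k) = ε a_n  for every n.
  Eigen : Carrier → Carrier → (ℕ → Carrier) → Set ℓ
  Eigen m ε a = ∀ n → sumTo n (λ k → binom (ιℕ n - m) k * sgn (n ∸ k) * a (n ∸ k)) ≈ ε * a n

  eigen-reversed : ∀ {p ε b} → Eigen p ε b →
    ∀ k → sumTo k (λ i → binom (ιℕ k - p) (k ∸ i) * sgn i * b i) ≈ ε * b k
  eigen-reversed {p} {ε} {b} eigen k = begin
    sumTo k (λ i → binom (ιℕ k - p) (k ∸ i) * sgn i * b i)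
      ≈⟨ sum-reverse k _ ⟩
    sumTo k (λ s → binom (ιℕ k - p) (k ∸ (k ∸ s)) * sgn (k ∸ s) * b (k ∸ s))
      ≈⟨ sum-cong k (λ s s≤k → reflexive (P.cong (λ j → binom (ιℕ k - p) j * sgn (k ∸ s) * b (k ∸ s)) (NP.m∸[m∸n]≡n s≤k))) ⟩
    sumTo k (λ s → binom (ιℕ k - p) s * sgn (k ∸ s) * b (k ∸ s))
      ≈⟨ eigen k ⟩
    ε * b k ∎

  convolution-term : Carrier → Carrier → (ℕ → Carrier) → (ℕ → Carrier) → ℕ → ℕ → Carrier
  convolution-term m p a b n k = falling (ιℕ n - m) k * falling (ιℕ n - p) (n ∸ k) * sgn k * a (n ∸ k) * b k

  convolution : Carrier → Carrier → (ℕ → Carrier) → (ℕ → Carrier) → ℕ → Carrier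
  convolution m p a b n = sumTo n (convolution-term m p a b n)

  -- Main identity: for eigensequences a, b with eigenvalues εa, εb,
  --   εa Φ_n = (-1)^n εb Φ_n,
  -- obtained by summing the triangular array `entry` by columns and by rows.
  module _ {m p εa εb a b} (eigen-a : Eigen m εa a) (eigen-b : Eigen p εb b) (n : ℕ) where
    private
      M Q : Carrier
      M = ιℕ n - m
      Q = ιℕ n - p

      term : ℕ → Carrier
      term = convolution-term m p a b n

      entry : ℕ → ℕ → Carrier
      entry k i = falling M k * inv (ιℕ ((k ∸ i) !)) * falling Q (n ∸ i) * sgn i * sgn (n ∸ k) * a (n ∸ k) * b i

      column-entry : ∀ i t → i ≤ℕ n →
        entry (i +ℕ t) i ≈ (falling M i * falling Q (n ∸ i) * sgn i * b i)
                             * (binom (ιℕ (n ∸ i) - m) t * sgn (n ∸ i ∸ t) * a (n ∸ i ∸ t))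
      column-entry i t i≤n rewrite NP.m+n∸m≡n i t | P.sym (NP.∸-+-assoc n i t) = begin
        falling M (i +ℕ t) * inv (ιℕ (t !)) * falling Q (n ∸ i) * sgn i * sgn (n ∸ i ∸ t) * a (n ∸ i ∸ t) * b i
          ≈⟨ *-cong (*-cong (*-cong (*-cong (*-cong (*-cong (falling-shift m t i≤n) refl) refl) refl) refl) refl) refl ⟩
        falling M i * falling (ιℕ (n ∸ i) - m) t * inv (ιℕ (t !)) * falling Q (n ∸ i) * sgn i * sgn (n ∸ i ∸ t) * a (n ∸ i ∸ t) * b i
          ≈⟨ solve 8 (λ A B C D E G H I → A :* B :* C :* D :* E :* G :* H :* I := (A :* D :* E :* I) :* (B :* C :* G :* H)) refl _ _ _ _ _ _ _ _ ⟩
        (falling M i * falling Q (n ∸ i) * sgn i * b i) * (binom (ιℕ (n ∸ i) - m) t * sgn (n ∸ i ∸ t) * a (n ∸ i ∸ t)) ∎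

      column-sum : ∀ i → i ≤ℕ n → sumTo (n ∸ i) (λ t → entry (i +ℕ t) i) ≈ εa * term i
      column-sum i i≤n = begin
        sumTo (n ∸ i) (λ t → entry (i +ℕ t) i)
          ≈⟨ sum-cong (n ∸ i) (λ t _ → column-entry i t i≤n) ⟩
        sumTo (n ∸ i) (λ t → factor * (binom (ιℕ (n ∸ i) - m) t * sgn (n ∸ i ∸ t) * a (n ∸ i ∸ t)))
          ≈⟨ sum-scale (n ∸ i) _ _ ⟩
        factor * sumTo (n ∸ i) (λ t → binom (ιℕ (n ∸ i) - m) t * sgn (n ∸ i ∸ t) * a (n ∸ i ∸ t))
          ≈⟨ *-cong refl (eigen-a (n ∸ i)) ⟩
        factor * (εa * a (n ∸ i))
          ≈⟨ solve 6 (λ A B C D S E → (A :* B :* C :* D) :* (S :* E) := S :* (A :* B :* C :* E :* D)) refl _ _ _ _ _ _ ⟩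
        εa * term i ∎
        where
        factor : Carrier
        factor = falling M i * falling Q (n ∸ i) * sgn i * b i

      row-entry : ∀ k i → k ≤ℕ n → i ≤ℕ k →
        entry k i ≈ (falling M k * sgn (n ∸ k) * a (n ∸ k) * falling Q (n ∸ k))
                      * (binom (ιℕ k - p) (k ∸ i) * sgn i * b i)
      row-entry k i k≤n i≤k = begin
        falling M k * inv (ιℕ ((k ∸ i) !)) * falling Q (n ∸ i) * sgn i * sgn (n ∸ k) * a (n ∸ k) * b i
          ≈⟨ *-cong (*-cong (*-cong (*-cong (*-cong refl split-Q) refl) refl) refl) refl ⟩
        falling M k * inv (ιℕ ((k ∸ i) !)) * (falling Q (n ∸ k) * falling (ιℕ k - p) (k ∸ i)) * sgn i * sgn (n ∸ k) * a (n ∸ k) * b i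
          ≈⟨ solve 8 (λ A C D B E G H I → A :* C :* (D :* B) :* E :* G :* H :* I := (A :* G :* H :* D) :* (B :* C :* E :* I)) refl _ _ _ _ _ _ _ _ ⟩
        (falling M k * sgn (n ∸ k) * a (n ∸ k) * falling Q (n ∸ k)) * (binom (ιℕ k - p) (k ∸ i) * sgn i * b i) ∎
        where
        -- (Q)_(n-i) = (Q)_(n-k) (k-p)_(k-i), the shift with n - k in place of i
        split-Q : falling Q (n ∸ i) ≈ falling Q (n ∸ k) * falling (ιℕ k - p) (k ∸ i)
        split-Q = begin
          falling Q (n ∸ i)
            ≡⟨ P.cong (falling Q) n∸i≡[n∸k]+[k∸i] ⟩
          falling Q (n ∸ k +ℕ (k ∸ i))
            ≈⟨ falling-shift p (k ∸ i) (NP.m∸n≤m n k) ⟩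
          falling Q (n ∸ k) * falling (ιℕ (n ∸ (n ∸ k)) - p) (k ∸ i)
            ≡⟨ P.cong (λ j → falling Q (n ∸ k) * falling (ιℕ j - p) (k ∸ i)) (NP.m∸[m∸n]≡n k≤n) ⟩
          falling Q (n ∸ k) * falling (ιℕ k - p) (k ∸ i) ∎
          where
          n∸i≡[n∸k]+[k∸i] : n ∸ i ≡ n ∸ k +ℕ (k ∸ i)
          n∸i≡[n∸k]+[k∸i] = P.sym (P.trans (P.sym (NP.+-∸-assoc (n ∸ k) i≤k)) (P.cong (_∸ i) (NP.m∸n+n≡m k≤n)))

      row-sum : ∀ k → k ≤ℕ n → sumTo k (entry k) ≈ sgn n * (εb * term k)
      row-sum k k≤n = begin
        sumTo k (entry k)
          ≈⟨ sum-cong k (λ i i≤k → row-entry k i k≤n i≤k) ⟩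
        sumTo k (λ i → factor * (binom (ιℕ k - p) (k ∸ i) * sgn i * b i))
          ≈⟨ sum-scale k _ _ ⟩
        factor * sumTo k (λ i → binom (ιℕ k - p) (k ∸ i) * sgn i * b i)
          ≈⟨ *-cong refl (eigen-reversed eigen-b k) ⟩
        falling M k * sgn (n ∸ k) * a (n ∸ k) * falling Q (n ∸ k) * (εb * b k)
          ≈⟨ *-cong (*-cong (*-cong (*-cong refl (sgn-∸ k≤n)) refl) refl) refl ⟩
        falling M k * (sgn n * sgn k) * a (n ∸ k) * falling Q (n ∸ k) * (εb * b k)
          ≈⟨ solve 7 (λ A N K E D S B → A :* (N :* K) :* E :* D :* (S :* B) := N :* (S :* (A :* D :* K :* E :* B))) refl _ _ _ _ _ _ _ ⟩
        sgn n * (εb * term k) ∎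
        where
        factor : Carrier
        factor = falling M k * sgn (n ∸ k) * a (n ∸ k) * falling Q (n ∸ k)

    eigen-convolution : εa * convolution m p a b n ≈ sgn n * (εb * convolution m p a b n)
    eigen-convolution = begin
      εa * convolution m p a b n                               ≈⟨ sym (sum-scale n εa term) ⟩
      sumTo n (λ i → εa * term i)                              ≈⟨ sym (sum-cong n column-sum) ⟩
      sumTo n (λ i → sumTo (n ∸ i) (λ t → entry (i +ℕ t) i))   ≈⟨ sym (sum-triangle n entry) ⟩
      sumTo n (λ k → sumTo k (entry k))                        ≈⟨ sum-cong n row-sum ⟩
      sumTo n (λ k → sgn n * (εb * term k))                    ≈⟨ sum-scale n _ _ ⟩
      sgn n * sumTo n (λ k → εb * term k)                      ≈⟨ *-cong refl (sum-scale n εb term) ⟩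
      sgn n * (εb * convolution m p a b n)                     ∎

theorem2p6 : ∀ {c ℓ} (F : Char0Field c ℓ) → let open Char0Field F in
    (m p : Carrier) (α β : ℤ) (a b : ℕ → Carrier) →
    (∀ n → sumTo n (λ k → binom (ιℕ n - m) k * sgn (n ∸ k) * a (n ∸ k)) ≈ sgnℤ α * a n) →
    (∀ n → sumTo n (λ k → binom (ιℕ n - p) k * sgn (n ∸ k) * b (n ∸ k)) ≈ sgnℤ β * b n) →
    (n : ℕ) → ∣ α +ℤ β +ℤ + n ∣ % 2 ≡ 1 →
    sumTo n (λ k → ((binom (ιℕ n - m) k * binom (ιℕ n - p) (n ∸ k)) ÷ ιℕ (n C k))
                     * sgn k * a (n ∸ k) * b k) ≈ 0#
theorem2p6 F m p α β a b eigen-a eigen-b n odd = begin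
  sumTo n (λ k → ((binom M k * binom Q (n ∸ k)) ÷ ιℕ (n C k)) * sgn k * a (n ∸ k) * b k)
    ≈⟨ sum-cong n normalised-summand ⟩
  sumTo n (λ k → inv (ιℕ (n !)) * convolution-term m p a b n k)
    ≈⟨ sum-scale n _ _ ⟩
  inv (ιℕ (n !)) * convolution m p a b n
    ≈⟨ *-cong refl (odd-sign-vanish α β n odd (eigen-convolution eigen-a eigen-b n)) ⟩
  inv (ιℕ (n !)) * 0#
    ≈⟨ zeroʳ _ ⟩
  0# ∎
  where
  open Char0Field F
  open Development F
  open import Relation.Binary.Reasoning.Setoid setoid
  open import Algebra.Solver.Ring.NaturalCoefficients.Default commutativeSemiring

  M Q : Carrier
  M = ιℕ n - m
  Q = ιℕ n - p

  normalised-summand : ∀ k → k ≤ℕ n →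
    ((binom M k * binom Q (n ∸ k)) ÷ ιℕ (n C k)) * sgn k * a (n ∸ k) * b k
      ≈ inv (ιℕ (n !)) * convolution-term m p a b n k
  normalised-summand k k≤n = trans (*-cong (*-cong (*-cong (binom-ratio M Q k≤n) refl) refl) refl)
    (solve 6 (λ i x y s u v → i :* (x :* y) :* s :* u :* v := i :* (x :* y :* s :* u :* v)) refl _ _ _ _ _ _)
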